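{- Let $G$ be a connected graph on $n$ vertices. If $\Delta(G)\geq n-5$, then $c(G)\leq 2$.
   Context: $\Delta(G)$ is the maximum degree of $G$. Game of cops and robbers: first $k$ cops are placed on vertices, then the robber; players alternate moves, cops first; each cop (resp. the robber) moves to a neighboring vertex or stays put; full information; cops win if some cop eventually occupies the robber's vertex. $c(G)$ is the minimum number of cops that can guarantee a win. -}

module Defs where

open import Data.Nat using (ℕ; _⊔_)
open import Data.Fin using (Fin)
open import Data.Bool using (Bool; true; false)
open import Data.List using (List; length; filterᵇ; allFin; map; foldr)
open import Data.Product using (∃; _×_; _,_)
open import Data.Sum using (_⊎_)
open import Relation.Binary.PropositionalEquality using (_≡_)

record Graph (n : ℕ) : Set where
  field
    adj     : Fin n → Fin n → Bool
    sym     : ∀ u v → adj u v ≡ adj v u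
    irrefl  : ∀ v → adj v v ≡ false

open Graph public

Adj : ∀ {n} → Graph n → Fin n → Fin n → Set
Adj G u v = adj G u v ≡ true

degree : ∀ {n} → Graph n → Fin n → ℕ
degree {n} G v = length (filterᵇ (adj G v) (allFin n))

-- Δ(G): maximum degree (0 for the empty graph)
maxDegree : ∀ {n} → Graph n → ℕ
maxDegree {n} G = foldr _⊔_ 0 (map (degree G) (allFin n))

data Reachable {n} (G : Graph n) : Fin n → Fin n → Set where
  here : ∀ {u} → Reachable G u u
  step : ∀ {u v w} → Adj G u v → Reachable G v w → Reachable G u w

record Connected {n} (G : Graph n) : Set where
  field
    vertex : Fin n
    paths  : ∀ u v → Reachable G u v

Caught : ∀ {n k} → (Fin k → Fin n) → Fin n → Set
Caught cs r = ∃ λ i → cs i ≡ r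

Step : ∀ {n} → Graph n → Fin n → Fin n → Set
Step G u u' = u' ≡ u ⊎ Adj G u u'

CopMove : ∀ {n k} → Graph n → (Fin k → Fin n) → (Fin k → Fin n) → Set
CopMove G cs cs' = ∀ i → Step G (cs i) (cs' i)

-- Positions from which the cops can force a capture in finitely many
-- moves (least fixed point = winning region of the reachability game).
mutual
  data CopTurnWin {n k} (G : Graph n) : (Fin k → Fin n) → Fin n → Set where
    caughtC : ∀ {cs r} → Caught cs r → CopTurnWin G cs r
    move    : ∀ {cs r} (cs' : Fin k → Fin n) → CopMove G cs cs' →
              RobberTurnWin G cs' r → CopTurnWin G cs r

  data RobberTurnWin {n k} (G : Graph n) : (Fin k → Fin n) → Fin n → Set where
    caughtR : ∀ {cs r} → Caught cs r → RobberTurnWin G cs r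
    respond : ∀ {cs r} → (∀ r' → Step G r r' → CopTurnWin G cs r') →
              RobberTurnWin G cs r

-- k cops have a winning strategy: cops are placed first, then the robber,
-- then play alternates starting with the cops.
CopsWin : ∀ {n} → Graph n → ℕ → Set
CopsWin {n} G k = ∃ λ (cs : Fin k → Fin n) → ∀ r → CopTurnWin G cs r

-- Let v be a vertex of maximum degree, so that at most four vertices lie outside N[v].
-- One cop stays on v, so the robber can never enter N[v] without being caught, and the
-- other cop, moving freely in G, only has to catch a robber confined to the graph H
-- induced on those four vertices. Unless H is a 4-cycle, some vertex q of H is a good
-- base for the second cop: every vertex of H is either dominated, up to N[v], by a
-- neighbour of q (a robber there is caught within one move), or its closed neighbourhood
-- in H is a whole component of H (a robber there is trapped while the cop walks to it).
-- That this holds for every graph on four labelled vertices other than the three 4-cycles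
-- is checked by evaluation. When H is a 4-cycle abcd, the cop on v leaves it once: it
-- steps to a neighbour w of a, and a robber fleeing from a into N(v) is cornered by a
-- second coordinated move of both cops.

module Submission where

open import Defs hiding (sym)
open import Data.Bool using (Bool; true; false)
open import Data.Bool.Properties using (T-≡) renaming (_≟_ to _≟ᵇ_)
open import Data.Empty using (⊥; ⊥-elim)
open import Data.Fin using (Fin; zero; suc; _≟_)
open import Data.Fin.Patterns using (0F; 1F; 2F; 3F)
open import Data.Fin.Properties using (any?; all?)
open import Data.List using (List; []; _∷_; length; filter; allFin; map; foldr)
open import Data.List.Membership.Propositional using (_∈_)
open import Data.List.Membership.Propositional.Properties using (∈-allFin; ∈-filter⁺; ∈-filter⁻)
open import Data.List.Properties using (filter-notAll; length-tabulate)
open import Data.List.Relation.Unary.Any using (here; there)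
import Data.List.Relation.Unary.Any as Any
open import Data.Nat using (ℕ; suc; _+_; _∸_; _≤_; _⊔_; z≤n; s≤s)
open import Data.Nat.Properties
  using (⊔-sel; ≤-refl; ≤-reflexive; ≤-trans; <-≤-trans; ≤-pred; +-suc; +-comm; +-monoʳ-≤; +-cancelˡ-≤;
         m≤n+m∸n; module ≤-Reasoning)
open import Data.Product using (∃; _×_; _,_; proj₁; proj₂)
import Data.Product as Product
open import Data.Sum using (_⊎_; inj₁; inj₂; [_,_])
import Data.Sum as Sum
open import Function using (_∘_; id)
open import Function.Bundles using (Equivalence)
open import Relation.Binary.PropositionalEquality using (_≡_; refl; sym; trans; cong; subst)
open import Relation.Nullary using (Dec; yes; no; ¬_; ¬?; does)
open import Relation.Nullary.Decidable using (T?; _×-dec_; _⊎-dec_; _→-dec_; from-yes; map′)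
open import Relation.Unary using (Decidable)
open import Relation.Unary.Properties using (∁?)

length-filter-∁ : ∀ {A : Set} {P : A → Set} (P? : Decidable P) xs →
  length (filter P? xs) + length (filter (∁? P?) xs) ≡ length xs
length-filter-∁ P? [] = refl
length-filter-∁ P? (x ∷ xs) with does (P? x)
... | true  = cong suc (length-filter-∁ P? xs)
... | false = trans (+-suc _ _) (cong suc (length-filter-∁ P? xs))

enumerate : ∀ {A : Set} {k} (d : A) (xs : List A) → length xs ≤ k →
  ∃ λ (w : Fin k → A) → (∀ {x} → x ∈ xs → ∃ λ i → w i ≡ x) × (∀ i → w i ≡ d ⊎ w i ∈ xs)
enumerate d [] _ = (λ _ → d) , (λ ()) , (λ _ → inj₁ refl)
enumerate {k = suc k} d (x ∷ xs) (s≤s len) with enumerate d xs len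
... | w , onto , range = w′ , onto′ , range′
  where
  w′ : Fin (suc k) → _
  w′ zero    = x
  w′ (suc i) = w i
  onto′ : ∀ {y} → y ∈ x ∷ xs → ∃ λ i → w′ i ≡ y
  onto′ (here refl) = zero , refl
  onto′ (there y∈xs) = Product.map suc id (onto y∈xs)
  range′ : ∀ i → w′ i ≡ d ⊎ w′ i ∈ x ∷ xs
  range′ zero    = inj₂ (here refl)
  range′ (suc i) = Sum.map₂ there (range i)

foldr-⊔-attained : ∀ {A : Set} (d : A) (f : A → ℕ) xs → ∃ λ x → foldr _⊔_ 0 (map f xs) ≤ f x
foldr-⊔-attained d f [] = d , z≤n
foldr-⊔-attained d f (x ∷ xs) with ⊔-sel (f x) (foldr _⊔_ 0 (map f xs))
... | inj₁ max≡fx = x , ≤-reflexive max≡fx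
... | inj₂ max≡rest with foldr-⊔-attained d f xs
...   | y , rest≤fy = y , ≤-trans (≤-reflexive max≡rest) rest≤fy

In4 : {A : Set} → A → A → A → A → A → Set
In4 a b c d x = x ≡ a ⊎ x ≡ b ⊎ x ≡ c ⊎ x ≡ d

In4-map : ∀ {A B : Set} (f : A → B) {a b c d x} → In4 a b c d x → In4 (f a) (f b) (f c) (f d) (f x)
In4-map f = Sum.map (cong f) (Sum.map (cong f) (Sum.map (cong f) (cong f)))

In4-rotate : ∀ {A : Set} {a b c d x : A} → In4 a b c d x → In4 b c d a x
In4-rotate (inj₁ x≡a) = inj₂ (inj₂ (inj₂ x≡a))
In4-rotate (inj₂ m)   = Sum.map₂ (Sum.map₂ inj₁) m

module _ {n : ℕ} (G : Graph n) where

  adj-sym : ∀ {x y} → Adj G x y → Adj G y x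
  adj-sym {x} {y} = trans (Graph.sym G y x)

  ¬adj-refl : ∀ {x} → ¬ Adj G x x
  ¬adj-refl {x} x∼x with trans (sym (irrefl G x)) x∼x
  ... | ()

  adj? : ∀ x y → Dec (Adj G x y)
  adj? x y = adj G x y ≟ᵇ true

  step? : ∀ x y → Dec (Step G x y)
  step? x y = (y ≟ x) ⊎-dec adj? x y

  non-neighbours : Fin n → List (Fin n)
  non-neighbours v = filter (∁? (T? ∘ adj G v)) (allFin n)

  degree+non-neighbours : ∀ v → degree G v + length (non-neighbours v) ≡ n
  degree+non-neighbours v = trans (length-filter-∁ (T? ∘ adj G v) (allFin n)) (length-tabulate id)

  ∈-non-neighbours : ∀ {v u} → ¬ Adj G v u → u ∈ non-neighbours v
  ∈-non-neighbours {v} v≁u = ∈-filter⁺ (∁? (T? ∘ adj G v)) (∈-allFin _) (v≁u ∘ Equivalence.to T-≡)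

  ∈-non-neighbours⁻ : ∀ {v u} → u ∈ non-neighbours v → ¬ Adj G v u
  ∈-non-neighbours⁻ {v} u∈ =
    proj₂ (∈-filter⁻ (∁? (T? ∘ adj G v)) {xs = allFin n} u∈) ∘ Equivalence.from T-≡

  outside : Fin n → List (Fin n)
  outside v = filter (¬? ∘ (_≟ v)) (non-neighbours v)

  length-outside : ∀ {k} v → n ∸ suc k ≤ degree G v → length (outside v) ≤ k
  length-outside {k} v deg≥ = ≤-pred (<-≤-trans (filter-notAll _ _ v∈) non-neighbours≤)
    where
    v∈ = Any.map (λ { refl v≢v → v≢v refl }) (∈-non-neighbours (¬adj-refl {v}))
    non-neighbours≤ : length (non-neighbours v) ≤ suc k
    non-neighbours≤ = +-cancelˡ-≤ (degree G v) _ _ (begin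
      degree G v + length (non-neighbours v) ≡⟨ degree+non-neighbours v ⟩
      n                                      ≤⟨ m≤n+m∸n n (suc k) ⟩
      suc k + (n ∸ suc k)                    ≤⟨ +-monoʳ-≤ (suc k) deg≥ ⟩
      suc k + degree G v                     ≡⟨ +-comm (suc k) (degree G v) ⟩
      degree G v + suc k                     ∎)
      where open ≤-Reasoning

  -- w pads with v, and so repeats vertices, when fewer than k vertices lie outside N[v].
  few-non-neighbours : ∀ {k} v → n ∸ suc k ≤ degree G v →
    ∃ λ (w : Fin k → Fin n) → (∀ i → ¬ Adj G v (w i)) × (∀ u → Step G v u ⊎ ∃ λ i → w i ≡ u)
  few-non-neighbours v deg≥ with enumerate v (outside v) (length-outside v deg≥)
  ... | w , onto , range = w , v≁w , cover
    where
    v≁w : ∀ i → ¬ Adj G v (w i)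
    v≁w i with range i
    ... | inj₁ wi≡v = subst (λ x → ¬ Adj G v x) (sym wi≡v) ¬adj-refl
    ... | inj₂ wi∈ = ∈-non-neighbours⁻ (proj₁ (∈-filter⁻ (¬? ∘ (_≟ v)) wi∈))
    cover : ∀ u → Step G v u ⊎ ∃ λ i → w i ≡ u
    cover u with step? v u
    ... | yes near = inj₁ near
    ... | no far = inj₂ (onto (∈-filter⁺ (¬? ∘ (_≟ v)) (∈-non-neighbours (far ∘ inj₂)) (far ∘ inj₁)))

module TwoCops {n : ℕ} (G : Graph n) where

  cops : Fin n → Fin n → Fin 2 → Fin n
  cops x y zero       = x
  cops x y (suc zero) = y

  Win : Fin n → Fin n → Fin n → Set
  Win x y = CopTurnWin G (cops x y)

  capture : ∀ {x y r} → Step G x r ⊎ Step G y r → Win x y r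
  capture (inj₁ (inj₁ refl)) = caughtC (zero , refl)
  capture (inj₂ (inj₁ refl)) = caughtC (suc zero , refl)
  capture {y = y} {r} (inj₁ (inj₂ x∼r)) =
    move (cops r y) (λ { zero → inj₂ x∼r ; (suc zero) → inj₁ refl }) (caughtR (zero , refl))
  capture {x = x} {r = r} (inj₂ (inj₂ y∼r)) =
    move (cops x r) (λ { zero → inj₁ refl ; (suc zero) → inj₂ y∼r }) (caughtR (suc zero , refl))

  move-then : ∀ {x y x′ y′ r} → Step G x x′ → Step G y y′ →
    (∀ r′ → Step G r r′ → Win x′ y′ r′) → Win x y r
  move-then {x′ = x′} {y′} x→x′ y→y′ k =
    move (cops x′ y′) (λ { zero → x→x′ ; (suc zero) → y→y′ }) (respond k)

  move-then-capture : ∀ {x y x′ y′ r} → Step G x x′ → Step G y y′ →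
    (∀ r′ → Step G r r′ → Step G x′ r′ ⊎ Step G y′ r′) → Win x y r
  move-then-capture x→x′ y→y′ h = move-then x→x′ y→y′ (λ r′ r→r′ → capture (h r′ r→r′))

  module _ {s x : Fin n} (C : Fin n → Set) (dominated : ∀ {u} → C u → Step G x u)
           (closed : ∀ {u u′} → C u → Adj G u u′ → C u′ ⊎ Step G s u′) where

    sweep : ∀ {p r} → Reachable G p x → C r → Win p s r
    sweep here r∈C = capture (inj₁ (dominated r∈C))
    sweep (step p∼p′ path) r∈C = move-then (inj₂ p∼p′) (inj₁ refl) λ where
      r′ (inj₁ refl) → sweep path r∈C
      r′ (inj₂ r∼r′) → [ sweep path , capture ∘ inj₂ ] (closed r∈C r∼r′)

module Guarding {n : ℕ} (G : Graph n) (v : Fin n) where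
  open TwoCops G

  -- With one cop on v: from q, the other cop catches a robber on x in one move (Cornered),
  -- or a robber on x can never leave N[x] (Enclosed).
  Cornered : Fin n → Fin n → Set
  Cornered q x = ∃ λ y → Step G q y × ∀ {u} → Step G x u → Step G y u ⊎ Step G v u

  Enclosed : Fin n → Set
  Enclosed x = ∀ {u u′} → Step G x u → ¬ Step G v u → Adj G u u′ → Step G x u′ ⊎ Step G v u′

  guarded-win : (∀ u u′ → Reachable G u u′) → ∀ q →
    (∀ r → Step G v r ⊎ Cornered q r ⊎ Enclosed r) → CopsWin G 2
  guarded-win paths q h = cops q v , λ r → play r (h r)
    where
    play : ∀ r → Step G v r ⊎ Cornered q r ⊎ Enclosed r → Win q v r
    play r (inj₁ near) = capture (inj₂ near)
    play r (inj₂ (inj₁ (y , q→y , dominated))) = move-then-capture q→y (inj₁ refl) (λ _ → dominated)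
    play r (inj₂ (inj₂ enclosed)) with step? G v r
    ... | yes near = capture (inj₂ near)
    ... | no far = sweep Trapped proj₁ closed (paths q r) (inj₁ refl , far)
      where
      Trapped : Fin n → Set
      Trapped u = Step G r u × ¬ Step G v u
      closed : ∀ {u u′} → Trapped u → Adj G u u′ → Trapped u′ ⊎ Step G v u′
      closed (r→u , far-u) u∼u′ with enclosed r→u far-u u∼u′ | step? G v _
      ... | inj₂ near | _        = inj₂ near
      ... | inj₁ _    | yes near = inj₂ near
      ... | inj₁ r→u′ | no far′  = inj₁ (r→u′ , far′)

record C4Outside {n : ℕ} (G : Graph n) (v a b c d : Fin n) : Set where
  field
    cover : ∀ u → Step G v u ⊎ In4 a b c d u
    v≁a : ¬ Adj G v a
    v≁b : ¬ Adj G v b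
    v≁c : ¬ Adj G v c
    v≁d : ¬ Adj G v d
    a∼b : Adj G a b
    b∼c : Adj G b c
    c∼d : Adj G c d
    d∼a : Adj G d a
    a≁c : ¬ Adj G a c
    b≁d : ¬ Adj G b d

rotate : ∀ {n} {G : Graph n} {v a b c d} → C4Outside G v a b c d → C4Outside G v b c d a
rotate {G = G} S = record
  { cover = Sum.map₂ In4-rotate ∘ cover
  ; v≁a = v≁b ; v≁b = v≁c ; v≁c = v≁d ; v≁d = v≁a
  ; a∼b = b∼c ; b∼c = c∼d ; c∼d = d∼a ; d∼a = a∼b
  ; a≁c = b≁d ; b≁d = a≁c ∘ adj-sym G }
  where open C4Outside S

NoCommonNeighbour : ∀ {n} → Graph n → (a b c d : Fin n) → Set
NoCommonNeighbour G a b c d = ∀ {f} → Adj G f a → Adj G f b → Adj G f c → Adj G f d → ⊥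

module C4Strategy {n : ℕ} (G : Graph n) (paths : ∀ u u′ → Reachable G u u′)
                  {v a b c d : Fin n} (S : C4Outside G v a b c d) where
  open TwoCops G
  open C4Outside S

  a-neighbours : ∀ {u} → Adj G a u → Adj G v u ⊎ u ≡ b ⊎ u ≡ d
  a-neighbours {u} a∼u with cover u
  ... | inj₁ (inj₁ refl)                  = ⊥-elim (v≁a (adj-sym G a∼u))
  ... | inj₁ (inj₂ v∼u)                   = inj₁ v∼u
  ... | inj₂ (inj₁ refl)                  = ⊥-elim (¬adj-refl G a∼u)
  ... | inj₂ (inj₂ (inj₁ refl))           = inj₂ (inj₁ refl)
  ... | inj₂ (inj₂ (inj₂ (inj₁ refl)))    = ⊥-elim (a≁c a∼u)
  ... | inj₂ (inj₂ (inj₂ (inj₂ refl)))    = inj₂ (inj₂ refl)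

  leave-N[v] : ∀ {z x} → Adj G v z → (∀ {t} → In4 a b c d t → Adj G z t → Step G x t) →
    ∀ r′ → Step G z r′ → Step G v r′ ⊎ Step G x r′
  leave-N[v] v∼z h r′ (inj₁ refl) = inj₁ (inj₂ v∼z)
  leave-N[v] v∼z h r′ (inj₂ z∼r′) = Sum.map₂ (λ t → h t z∼r′) (cover r′)

  -- A robber fleeing to z ∈ N(v) is caught by moving the cops to (v, b) if z ≁ d, to (v, d)
  -- if z ≁ b, and otherwise to (w, v): then z sees a, b and d, hence not c.
  attack : ∀ {y w} → Adj G y b → Adj G y d → Adj G v w → Adj G w a →
    (∀ {z} → Adj G v z → Adj G z a → Adj G z b → Adj G z d → Adj G w b × Adj G w d × Adj G v y) →
    NoCommonNeighbour G a b c d → Win v y a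
  attack {y} {w} y∼b y∼d v∼w w∼a common noCommon = move-then (inj₂ v∼w) (inj₁ refl) respond-a
    where
    respond-a : ∀ z → Step G a z → Win w y z
    respond-a _ (inj₁ refl) = capture (inj₁ (inj₂ w∼a))
    respond-a z (inj₂ a∼z) with a-neighbours a∼z
    ... | inj₂ (inj₁ refl) = capture (inj₂ (inj₂ y∼b))
    ... | inj₂ (inj₂ refl) = capture (inj₂ (inj₂ y∼d))
    ... | inj₁ v∼z with adj? G z d | adj? G z b
    ...   | no z≁d | _ = move-then-capture (inj₂ (adj-sym G v∼w)) (inj₂ y∼b) (leave-N[v] v∼z b-covers)
      where
      b-covers : ∀ {t} → In4 a b c d t → Adj G z t → Step G b t
      b-covers (inj₁ refl)                 _   = inj₂ (adj-sym G a∼b)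
      b-covers (inj₂ (inj₁ refl))          _   = inj₁ refl
      b-covers (inj₂ (inj₂ (inj₁ refl)))   _   = inj₂ b∼c
      b-covers (inj₂ (inj₂ (inj₂ refl)))   z∼d = ⊥-elim (z≁d z∼d)
    ...   | yes _ | no z≁b = move-then-capture (inj₂ (adj-sym G v∼w)) (inj₂ y∼d) (leave-N[v] v∼z d-covers)
      where
      d-covers : ∀ {t} → In4 a b c d t → Adj G z t → Step G d t
      d-covers (inj₁ refl)                 _   = inj₂ d∼a
      d-covers (inj₂ (inj₁ refl))          z∼b = ⊥-elim (z≁b z∼b)
      d-covers (inj₂ (inj₂ (inj₁ refl)))   _   = inj₂ (adj-sym G c∼d)
      d-covers (inj₂ (inj₂ (inj₂ refl)))   _   = inj₁ refl
    ...   | yes z∼d | yes z∼b with common v∼z (adj-sym G a∼z) z∼b z∼d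
    ...     | w∼b , w∼d , v∼y =
      move-then-capture (inj₁ refl) (inj₂ (adj-sym G v∼y))
        (λ r′ z→r′ → Sum.swap (leave-N[v] v∼z w-covers r′ z→r′))
      where
      w-covers : ∀ {t} → In4 a b c d t → Adj G z t → Step G w t
      w-covers (inj₁ refl)                 _   = inj₂ w∼a
      w-covers (inj₂ (inj₁ refl))          _   = inj₂ w∼b
      w-covers (inj₂ (inj₂ (inj₁ refl)))   z∼c = ⊥-elim (noCommon (adj-sym G a∼z) z∼b z∼c z∼d)
      w-covers (inj₂ (inj₂ (inj₂ refl)))   _   = inj₂ w∼d

  catch-at-a : ∀ {y} → Adj G y b → Adj G y d → NoCommonNeighbour G a b c d →
    (∀ {z} → Adj G v z → Adj G z a → Adj G z b → Adj G z d → Adj G v y) → Win v y a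
  catch-at-a {y} y∼b y∼d noCommon triple⇒v∼y
    with any? (λ w → adj? G v w ×-dec adj? G w a ×-dec adj? G w b ×-dec adj? G w d)
  ... | yes (w , v∼w , w∼a , w∼b , w∼d) =
    attack y∼b y∼d v∼w w∼a
      (λ v∼z z∼a z∼b z∼d → w∼b , w∼d , triple⇒v∼y v∼z z∼a z∼b z∼d) noCommon
  ... | no noTriple with any? (λ w → adj? G v w ×-dec adj? G w a)
  ...   | yes (w , v∼w , w∼a) =
    attack y∼b y∼d v∼w w∼a
      (λ v∼z z∼a z∼b z∼d → ⊥-elim (noTriple (_ , v∼z , z∼a , z∼b , z∼d))) noCommon
  ...   | no a-far = sweep (_≡ a) inj₁ closed (paths v a) refl
    where
    closed : ∀ {u u′} → u ≡ a → Adj G u u′ → u′ ≡ a ⊎ Step G y u′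
    closed refl a∼u′ with a-neighbours a∼u′
    ... | inj₁ v∼u′        = ⊥-elim (a-far (_ , v∼u′ , adj-sym G a∼u′))
    ... | inj₂ (inj₁ refl) = inj₂ (inj₂ y∼b)
    ... | inj₂ (inj₂ refl) = inj₂ (inj₂ y∼d)

  dominated-win : ∀ {f} → Adj G f a → Adj G f b → Adj G f c → Adj G f d → CopsWin G 2
  dominated-win {f} f∼a f∼b f∼c f∼d = cops v f , λ r → capture (Sum.map₂ f-dominates (cover r))
    where
    f-dominates : ∀ {t} → In4 a b c d t → Step G f t
    f-dominates (inj₁ refl)               = inj₂ f∼a
    f-dominates (inj₂ (inj₁ refl))        = inj₂ f∼b
    f-dominates (inj₂ (inj₂ (inj₁ refl))) = inj₂ f∼c
    f-dominates (inj₂ (inj₂ (inj₂ refl))) = inj₂ f∼d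

  triple-win : NoCommonNeighbour G a b c d → ∀ {q} → Adj G q b → Adj G q c → Adj G q d → CopsWin G 2
  triple-win noCommon {q} q∼b q∼c q∼d = cops v q , λ r → play (cover r)
    where
    v∼q : Adj G v q
    v∼q with cover q
    ... | inj₁ (inj₁ refl)               = ⊥-elim (v≁b q∼b)
    ... | inj₁ (inj₂ v∼q)                = v∼q
    ... | inj₂ (inj₁ refl)               = ⊥-elim (a≁c q∼c)
    ... | inj₂ (inj₂ (inj₁ refl))        = ⊥-elim (¬adj-refl G q∼b)
    ... | inj₂ (inj₂ (inj₂ (inj₁ refl))) = ⊥-elim (¬adj-refl G q∼c)
    ... | inj₂ (inj₂ (inj₂ (inj₂ refl))) = ⊥-elim (¬adj-refl G q∼d)
    play : ∀ {r} → Step G v r ⊎ In4 a b c d r → Win v q r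
    play (inj₁ near)                      = capture (inj₁ near)
    play (inj₂ (inj₁ refl))               = catch-at-a q∼b q∼d noCommon (λ _ _ _ _ → v∼q)
    play (inj₂ (inj₂ (inj₁ refl)))        = capture (inj₂ (inj₂ q∼b))
    play (inj₂ (inj₂ (inj₂ (inj₁ refl)))) = capture (inj₂ (inj₂ q∼c))
    play (inj₂ (inj₂ (inj₂ (inj₂ refl)))) = capture (inj₂ (inj₂ q∼d))

c4-sparse-win : ∀ {n} (G : Graph n) → (∀ u u′ → Reachable G u u′) →
  ∀ {v a b c d} → C4Outside G v a b c d → NoCommonNeighbour G a b c d → CopsWin G 2
c4-sparse-win G paths {v} {a} {b} {c} {d} S noCommon
  with any? (λ q → adj? G q b ×-dec adj? G q c ×-dec adj? G q d)
... | yes (q , q∼b , q∼c , q∼d) = C4Strategy.triple-win G paths S noCommon q∼b q∼c q∼d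
... | no noTriple = cops v a , λ r → play (cover r)
  where
  open TwoCops G
  open C4Outside S
  play : ∀ {r} → Step G v r ⊎ In4 a b c d r → Win v a r
  play (inj₁ near)                      = capture (inj₁ near)
  play (inj₂ (inj₁ refl))               = capture (inj₂ (inj₁ refl))
  play (inj₂ (inj₂ (inj₁ refl)))        = capture (inj₂ (inj₂ a∼b))
  play (inj₂ (inj₂ (inj₂ (inj₁ refl)))) =
    C4Strategy.catch-at-a G paths (rotate (rotate S)) (adj-sym G d∼a) a∼b
      (λ f∼c f∼d f∼a f∼b → noCommon f∼a f∼b f∼c f∼d)
      (λ _ z∼c z∼d z∼b → ⊥-elim (noTriple (_ , z∼b , z∼c , z∼d)))
  play (inj₂ (inj₂ (inj₂ (inj₂ refl)))) = capture (inj₂ (inj₂ (adj-sym G d∼a)))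

c4-win : ∀ {n} (G : Graph n) → (∀ u u′ → Reachable G u u′) →
  ∀ {v a b c d} → C4Outside G v a b c d → CopsWin G 2
c4-win G paths {a = a} {b} {c} {d} S
  with any? (λ f → adj? G f a ×-dec adj? G f b ×-dec adj? G f c ×-dec adj? G f d)
... | yes (f , f∼a , f∼b , f∼c , f∼d) = C4Strategy.dominated-win G paths S f∼a f∼b f∼c f∼d
... | no noFull = c4-sparse-win G paths S (λ f∼a f∼b f∼c f∼d → noFull (_ , f∼a , f∼b , f∼c , f∼d))

record Graph₄ : Set where
  constructor mkGraph₄
  field e01 e02 e03 e12 e13 e23 : Bool

open Graph₄

edge : Graph₄ → Fin 4 → Fin 4 → Bool
edge p 0F 1F = e01 p
edge p 0F 2F = e02 p
edge p 0F 3F = e03 p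
edge p 1F 2F = e12 p
edge p 1F 3F = e13 p
edge p 2F 3F = e23 p
edge p 1F 0F = e01 p
edge p 2F 0F = e02 p
edge p 3F 0F = e03 p
edge p 2F 1F = e12 p
edge p 3F 1F = e13 p
edge p 3F 2F = e23 p
edge p _  _  = false

module _ (p : Graph₄) where

  Edge : Fin 4 → Fin 4 → Set
  Edge i j = edge p i j ≡ true

  Close : Fin 4 → Fin 4 → Set
  Close i j = j ≡ i ⊎ Edge i j

  Cornered₄ : Fin 4 → Fin 4 → Set
  Cornered₄ k i = ∃ λ j → Close k j × ∀ l → Close i l → Close j l

  Enclosed₄ : Fin 4 → Set
  Enclosed₄ i = ∀ j l → Close i j → Edge j l → Close i l

  Guardable₄ : Fin 4 → Set
  Guardable₄ k = ∀ i → Cornered₄ k i ⊎ Enclosed₄ i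

  IsC4 : Fin 4 → Fin 4 → Fin 4 → Fin 4 → Set
  IsC4 a b c d = (∀ i → In4 a b c d i) ×
    Edge a b × Edge b c × Edge c d × Edge d a × ¬ Edge a c × ¬ Edge b d

  Classified : Set
  Classified = (∃ λ k → Guardable₄ k) ⊎ (∃ λ a → ∃ λ b → ∃ λ c → ∃ λ d → IsC4 a b c d)

  private
    edge? : ∀ i j → Dec (Edge i j)
    edge? i j = edge p i j ≟ᵇ true

    close? : ∀ i j → Dec (Close i j)
    close? i j = (j ≟ i) ⊎-dec edge? i j

    in4? : (a b c d i : Fin 4) → Dec (In4 a b c d i)
    in4? a b c d i = (i ≟ a) ⊎-dec (i ≟ b) ⊎-dec (i ≟ c) ⊎-dec (i ≟ d)

  classified? : Dec Classified
  classified? =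
    any? (λ k → all? λ i →
      any? (λ j → close? k j ×-dec all? λ l → close? i l →-dec close? j l) ⊎-dec
      all? (λ j → all? λ l → close? i j →-dec edge? j l →-dec close? i l))
    ⊎-dec
    any? (λ a → any? λ b → any? λ c → any? λ d →
      all? (in4? a b c d) ×-dec edge? a b ×-dec edge? b c ×-dec edge? c d ×-dec edge? d a ×-dec
      ¬? (edge? a c) ×-dec ¬? (edge? b d))

∀-Bool? : {P : Bool → Set} → (∀ b → Dec (P b)) → Dec (∀ b → P b)
∀-Bool? P? = map′ (λ { (t , f) true → t ; (t , f) false → f }) (λ h → h true , h false)
  (P? true ×-dec P? false)

∀-Graph₄? : {P : Graph₄ → Set} → (∀ p → Dec (P p)) → Dec (∀ p → P p)
∀-Graph₄? P? = map′ (λ h p → h (e01 p) (e02 p) (e03 p) (e12 p) (e13 p) (e23 p))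
  (λ h a b c d e f → h (mkGraph₄ a b c d e f))
  (∀-Bool? λ a → ∀-Bool? λ b → ∀-Bool? λ c → ∀-Bool? λ d → ∀-Bool? λ e → ∀-Bool? λ f →
     P? (mkGraph₄ a b c d e f))

classify : ∀ p → Classified p
classify = from-yes (∀-Graph₄? classified?)

module Labelled {n : ℕ} (G : Graph n) (paths : ∀ u u′ → Reachable G u u′) (v : Fin n) (w : Fin 4 → Fin n)
                (v≁w : ∀ i → ¬ Adj G v (w i)) (cover : ∀ u → Step G v u ⊎ ∃ λ i → w i ≡ u) where
  open Guarding G v

  induced : Graph₄
  induced = mkGraph₄ (adj G (w 0F) (w 1F)) (adj G (w 0F) (w 2F)) (adj G (w 0F) (w 3F))
                     (adj G (w 1F) (w 2F)) (adj G (w 1F) (w 3F)) (adj G (w 2F) (w 3F))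

  adj≡edge : ∀ i j → adj G (w i) (w j) ≡ edge induced i j
  adj≡edge 0F 0F = irrefl G (w 0F)
  adj≡edge 1F 1F = irrefl G (w 1F)
  adj≡edge 2F 2F = irrefl G (w 2F)
  adj≡edge 3F 3F = irrefl G (w 3F)
  adj≡edge 0F 1F = refl
  adj≡edge 0F 2F = refl
  adj≡edge 0F 3F = refl
  adj≡edge 1F 2F = refl
  adj≡edge 1F 3F = refl
  adj≡edge 2F 3F = refl
  adj≡edge 1F 0F = Graph.sym G (w 1F) (w 0F)
  adj≡edge 2F 0F = Graph.sym G (w 2F) (w 0F)
  adj≡edge 3F 0F = Graph.sym G (w 3F) (w 0F)
  adj≡edge 2F 1F = Graph.sym G (w 2F) (w 1F)
  adj≡edge 3F 1F = Graph.sym G (w 3F) (w 1F)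
  adj≡edge 3F 2F = Graph.sym G (w 3F) (w 2F)

  edge⇒adj : ∀ {i j} → Edge induced i j → Adj G (w i) (w j)
  edge⇒adj {i} {j} = trans (adj≡edge i j)

  adj⇒edge : ∀ {i j} → Adj G (w i) (w j) → Edge induced i j
  adj⇒edge {i} {j} = trans (sym (adj≡edge i j))

  close⇒step : ∀ {i j} → Close induced i j → Step G (w i) (w j)
  close⇒step (inj₁ refl) = inj₁ refl
  close⇒step (inj₂ e)    = inj₂ (edge⇒adj e)

  cornered-sound : ∀ {k i} → Cornered₄ induced k i → Cornered (w k) (w i)
  cornered-sound {k} {i} (j , k→j , dominated) = w j , close⇒step k→j , λ {u} → reach u
    where
    reach : ∀ u → Step G (w i) u → Step G (w j) u ⊎ Step G v u
    reach u i→u with cover u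
    ... | inj₁ near = inj₂ near
    ... | inj₂ (l , refl) with i→u
    ...   | inj₁ wl≡wi = inj₁ (subst (Step G (w j)) (sym wl≡wi) (close⇒step (dominated i (inj₁ refl))))
    ...   | inj₂ wi∼wl = inj₁ (close⇒step (dominated l (inj₂ (adj⇒edge wi∼wl))))

  enclosed-sound : ∀ {i} → Enclosed₄ induced i → Enclosed (w i)
  enclosed-sound {i} enclosed {u} {u′} i→u far u∼u′ with cover u | cover u′
  ... | inj₁ near       | _               = ⊥-elim (far near)
  ... | inj₂ _          | inj₁ near′      = inj₂ near′
  ... | inj₂ (j , refl) | inj₂ (l , refl) with i→u
  ...   | inj₁ wj≡wi = inj₁ (inj₂ (subst (λ x → Adj G x (w l)) wj≡wi u∼u′))
  ...   | inj₂ wi∼wj = inj₁ (close⇒step (enclosed j l (inj₂ (adj⇒edge wi∼wj)) (adj⇒edge u∼u′)))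

  guardable-sound : ∀ {k} → Guardable₄ induced k → ∀ r → Step G v r ⊎ Cornered (w k) r ⊎ Enclosed r
  guardable-sound guardable r with cover r
  ... | inj₁ near       = inj₁ near
  ... | inj₂ (i , refl) = inj₂ (Sum.map cornered-sound enclosed-sound (guardable i))

  c4-sound : ∀ {a b c d} → IsC4 induced a b c d → C4Outside G v (w a) (w b) (w c) (w d)
  c4-sound {a} {b} {c} {d} (onto , ab , bc , cd , da , ac , bd) = record
    { cover = λ u → Sum.map₂ (λ { (i , refl) → In4-map w (onto i) }) (cover u)
    ; v≁a = v≁w a ; v≁b = v≁w b ; v≁c = v≁w c ; v≁d = v≁w d
    ; a∼b = edge⇒adj ab ; b∼c = edge⇒adj bc ; c∼d = edge⇒adj cd ; d∼a = edge⇒adj da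
    ; a≁c = ac ∘ adj⇒edge ; b≁d = bd ∘ adj⇒edge }

  classified-win : Classified induced → CopsWin G 2
  classified-win (inj₁ (k , guardable))      = guarded-win paths (w k) (guardable-sound guardable)
  classified-win (inj₂ (_ , _ , _ , _ , c4)) = c4-win G paths (c4-sound c4)

corollary1 : ∀ (n : ℕ) (G : Graph n) → Connected G → n ∸ 5 ≤ maxDegree G →
    ∃ λ k → k ≤ 2 × CopsWin G k
corollary1 n G connected n∸5≤Δ with foldr-⊔-attained (Connected.vertex connected) (degree G) (allFin n)
... | v , Δ≤deg with few-non-neighbours G v (≤-trans n∸5≤Δ Δ≤deg)
...   | w , v≁w , cover = 2 , ≤-refl , classified-win (classify induced)
  where open Labelled G (Connected.paths connected) v w v≁w cover
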